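{- Let $T$ be a tiling of the $n$-gon $P$. Every strand of the Scott strand construction for $T$ contains at most one of the strand segments of any given tile of $T$.
   Context: Let $P$ be a convex polygon with vertices $1,\dots,n$ ($n\ge3$) in clockwise order. A tiling $T$ is a (possibly empty) set of pairwise non-crossing (in their interiors) diagonals; tiles are the closures of the components of $P$ minus the diagonals. Scott strand construction: for each tile $Q$ with vertices $q_1,\dots,q_r$ in clockwise order (indices mod $r$) and each $j$, draw inside $Q$ a strand segment parallel to $[q_{j-1},q_j]$, entering $Q$ through the side $[q_j,q_{j+1}]$ near $q_j$ and leaving $Q$ through the side $[q_{j-2},q_{j-1}]$ near $q_{j-1}$; if the entering side is a boundary edge of $P$ the segment starts at vertex $q_j$, and if the leaving side is a boundary edge of $P$ it ends at vertex $q_{j-1}$. At a diagonal $d$ shared by two tiles, a segment leaving one tile through $d$ near an endpoint $v$ is continued by the segment of the other tile entering through $d$ near $v$. The resulting concatenated oriented curves are the strands; each starts and ends at a vertex of $P$. -}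

module Defs where

open import Data.Nat using (ℕ; zero; suc; _+_; _∸_; _<_; _≤_)
open import Data.Nat.DivMod using (_mod_)
open import Data.Fin using (Fin; toℕ; fromℕ; inject₁)
open import Data.Vec using (Vec; lookup)
open import Data.List using (List)
open import Data.List.Relation.Unary.All using (All)
open import Data.List.Membership.Propositional using (_∈_)
open import Data.Product using (Σ; _×_; _,_)
open import Data.Sum using (_⊎_)
open import Relation.Nullary using (¬_)
open import Relation.Binary.PropositionalEquality using (_≡_)

-- Vertices of the n-gon P are Fin n, labelled 0,…,n-1 in clockwise order
-- (paper's vertex i corresponds to i-1).

BoundaryEdge : (n : ℕ) → Fin n → Fin n → Set
BoundaryEdge n a b =
    (toℕ b ≡ suc (toℕ a)) ⊎ (toℕ a ≡ suc (toℕ b))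
  ⊎ ((toℕ a ≡ 0 × toℕ b ≡ n ∸ 1) ⊎ (toℕ b ≡ 0 × toℕ a ≡ n ∸ 1))

IsDiagonal : (n : ℕ) → Fin n × Fin n → Set
IsDiagonal n (a , b) = (toℕ a < toℕ b) × ¬ BoundaryEdge n a b

Crosses : {n : ℕ} → Fin n × Fin n → Fin n × Fin n → Set
Crosses (a , b) (c , d) =
    (toℕ a < toℕ c × toℕ c < toℕ b × toℕ b < toℕ d)
  ⊎ (toℕ c < toℕ a × toℕ a < toℕ d × toℕ d < toℕ b)

record Tiling (n : ℕ) : Set where
  field
    diags       : List (Fin n × Fin n)
    allDiag     : All (IsDiagonal n) diags
    nonCrossing : ∀ d e → d ∈ diags → e ∈ diags → ¬ Crosses d e
open Tiling public

InT : {n : ℕ} → Tiling n → Fin n → Fin n → Set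
InT T a b = ((a , b) ∈ diags T) ⊎ ((b , a) ∈ diags T)

Side : {n : ℕ} → Tiling n → Fin n → Fin n → Set
Side {n} T a b = BoundaryEdge n a b ⊎ InT T a b

nxt : {k : ℕ} → Fin (3 + k) → Fin (3 + k)
nxt {k} j = suc (toℕ j) mod (3 + k)

prv : {k : ℕ} → Fin (3 + k) → Fin (3 + k)
prv {k} j = (toℕ j + (2 + k)) mod (3 + k)

-- A candidate tile: a polygon with 3 + k vertices q₀,…,q_{k+2} listed in
-- clockwise order, starting from its smallest vertex.
TileShape : ℕ → Set
TileShape n = Σ ℕ (λ k → Vec (Fin n) (3 + k))

-- (k , q) is a tile of T, i.e. the closure of a component of P minus the
-- diagonals of T: its sides are boundary edges or diagonals of T, and no
-- diagonal of T passes through its interior (equivalently, since the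
-- diagonals of T are non-crossing, no diagonal of T joins two vertices of
-- the polygon that are not consecutive on it).
record IsTile {n : ℕ} (T : Tiling n) (Q : TileShape n) : Set where
  constructor mkTile
  open Σ Q renaming (proj₁ to k; proj₂ to q)
  field
    increasing : ∀ (i j : Fin (3 + k)) → toℕ i < toℕ j
                 → toℕ (lookup q i) < toℕ (lookup q j)
    sides      : ∀ (j : Fin (3 + k)) → Side T (lookup q j) (lookup q (nxt j))
    empty      : ∀ (i j : Fin (3 + k)) → ¬ (j ≡ nxt i) → ¬ (i ≡ nxt j)
                 → ¬ InT T (lookup q i) (lookup q j)

-- A strand segment: the j-th segment of the polygon (k , q): it is parallel
-- to [q_{j-1}, q_j], enters through side [q_j, q_{j+1}] near q_j and leaves
-- through side [q_{j-2}, q_{j-1}] near q_{j-1}.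
record Segment (n : ℕ) : Set where
  constructor seg
  field
    k     : ℕ
    verts : Vec (Fin n) (3 + k)
    idx   : Fin (3 + k)

  tile : TileShape n
  tile = k , verts

  v : Fin (3 + k) → Fin n
  v = lookup verts

  inFrom inTo outFrom outTo : Fin n
  inFrom  = v idx
  inTo    = v (nxt idx)
  outFrom = v (prv (prv idx))
  outTo   = v (prv idx)
open Segment public

StartsAtBoundary : {n : ℕ} → Segment n → Set
StartsAtBoundary {n} s = BoundaryEdge n (inFrom s) (inTo s)

EndsAtBoundary : {n : ℕ} → Segment n → Set
EndsAtBoundary {n} s = BoundaryEdge n (outFrom s) (outTo s)

-- s' continues s: s leaves through a diagonal d of T near its endpoint
-- u = q_{j-1}, and s' enters (its tile) through d near u.
Continues : {n : ℕ} → Tiling n → Segment n → Segment n → Set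
Continues T s s' =
  InT T (outFrom s) (outTo s) × (inFrom s' ≡ outTo s) × (inTo s' ≡ outFrom s)

record IsStrand {n : ℕ} (T : Tiling n) (m : ℕ) (s : Fin (suc m) → Segment n) : Set where
  field
    segTiles : ∀ i → IsTile T (tile (s i))
    starts   : StartsAtBoundary (s Data.Fin.zero)
    ends     : EndsAtBoundary (s (fromℕ m))
    linked   : ∀ (i : Fin m) → Continues T (s (inject₁ i)) (s (Data.Fin.suc i))

-- Give each segment s of a tile with vertices q₀ < … < q_{r-1} the closed clockwise
-- arc of vertex labels from its entering side's far end q_{j+1} round to its near
-- end q_j; it contains every vertex of the tile. The continuation of s enters
-- through the leaving side [q_{j-2}, q_{j-1}] of s, so its arc is [q_{j-2}, q_{j-1}],
-- which lies inside the arc of s but misses q_j. Hence the arcs along a strand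
-- decrease, and the vertex q_j at which a segment enters is excluded from the arc
-- of every later segment; a later segment of the same tile would contain it.
module Submission where

open import Defs
open import Data.Nat using (ℕ; zero; suc; _+_; _<_; _≤_; z≤n; s≤s; s≤s⁻¹; z<s; _%_)
open import Data.Nat.Properties
open import Data.Nat.DivMod using (_mod_; m%n<n; n%n≡0; [m+n]%n≡m%n; m<n⇒m%n≡m)
open import Data.Fin as Fin using (Fin; toℕ; inject₁)
open import Data.Fin.Induction using (<-weakInduction)
open import Data.Fin.Properties as Finₚ using (toℕ<n; toℕ≤pred[n]; toℕ-injective; toℕ-inject₁; toℕ-fromℕ<)
open import Data.Product using (_×_; _,_)
open import Data.Sum using (_⊎_; inj₁; inj₂)
open import Function using (_∘_)
open import Relation.Nullary using (¬_; yes; no; contradiction)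
open import Relation.Binary.PropositionalEquality
open import Relation.Binary.Definitions using (tri<; tri≈; tri>)

toℕ-mod : ∀ m r → toℕ (m mod suc r) ≡ m % suc r
toℕ-mod m r = toℕ-fromℕ< (m%n<n m (suc r))

toℕ-nxt : ∀ {k} (j : Fin (3 + k)) → toℕ j < 2 + k → toℕ (nxt j) ≡ suc (toℕ j)
toℕ-nxt {k} j j<last = trans (toℕ-mod (suc (toℕ j)) (2 + k)) (m<n⇒m%n≡m (s≤s j<last))

toℕ-nxt-last : ∀ {k} (j : Fin (3 + k)) → toℕ j ≡ 2 + k → toℕ (nxt j) ≡ 0
toℕ-nxt-last {k} j j≡last = begin
  toℕ (nxt j)           ≡⟨ toℕ-mod (suc (toℕ j)) (2 + k) ⟩
  suc (toℕ j) % (3 + k) ≡⟨ cong (λ t → suc t % (3 + k)) j≡last ⟩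
  (3 + k) % (3 + k)     ≡⟨ n%n≡0 (3 + k) ⟩
  0                     ∎
  where open ≡-Reasoning

toℕ-prv-zero : ∀ {k} (j : Fin (3 + k)) → toℕ j ≡ 0 → toℕ (prv j) ≡ 2 + k
toℕ-prv-zero {k} j j≡0 = begin
  toℕ (prv j)                 ≡⟨ toℕ-mod (toℕ j + (2 + k)) (2 + k) ⟩
  (toℕ j + (2 + k)) % (3 + k) ≡⟨ cong (λ t → (t + (2 + k)) % (3 + k)) j≡0 ⟩
  (2 + k) % (3 + k)           ≡⟨ m<n⇒m%n≡m (n<1+n (2 + k)) ⟩
  2 + k                       ∎
  where open ≡-Reasoning

toℕ-prv-suc : ∀ {k} (j : Fin (3 + k)) p → toℕ j ≡ suc p → toℕ (prv j) ≡ p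
toℕ-prv-suc {k} j p j≡1+p = begin
  toℕ (prv j)                 ≡⟨ toℕ-mod (toℕ j + (2 + k)) (2 + k) ⟩
  (toℕ j + (2 + k)) % (3 + k) ≡⟨ cong (λ t → (t + (2 + k)) % (3 + k)) j≡1+p ⟩
  (suc p + (2 + k)) % (3 + k) ≡⟨ cong (_% (3 + k)) (sym (+-suc p (2 + k))) ⟩
  (p + (3 + k)) % (3 + k)     ≡⟨ [m+n]%n≡m%n p (3 + k) ⟩
  p % (3 + k)                 ≡⟨ m<n⇒m%n≡m p<3+k ⟩
  p                           ∎
  where
  open ≡-Reasoning
  p<3+k : p < 3 + k
  p<3+k = <-trans (n<1+n p) (subst (_< 3 + k) j≡1+p (toℕ<n j))

toℕ-prv²-zero : ∀ {k} (j : Fin (3 + k)) → toℕ j ≡ 0 → toℕ (prv (prv j)) ≡ 1 + k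
toℕ-prv²-zero {k} j j≡0 = toℕ-prv-suc (prv j) (1 + k) (toℕ-prv-zero j j≡0)

toℕ-prv²-one : ∀ {k} (j : Fin (3 + k)) → toℕ j ≡ 1 → toℕ (prv (prv j)) ≡ 2 + k
toℕ-prv²-one j j≡1 = toℕ-prv-zero (prv j) (toℕ-prv-suc j 0 j≡1)

toℕ-prv²-suc² : ∀ {k} (j : Fin (3 + k)) p → toℕ j ≡ 2 + p → toℕ (prv (prv j)) ≡ p
toℕ-prv²-suc² j p j≡2+p = toℕ-prv-suc (prv j) p (toℕ-prv-suc j (suc p) j≡2+p)

last-or-before : ∀ {k} (j : Fin (3 + k)) → toℕ j ≡ 2 + k ⊎ toℕ j < 2 + k
last-or-before j with m≤n⇒m<n∨m≡n (toℕ≤pred[n] j)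
... | inj₁ j<last = inj₂ j<last
... | inj₂ j≡last = inj₁ j≡last

InArc : ℕ → ℕ → ℕ → Set
InArc a b x = (a ≤ b × a ≤ x × x ≤ b) ⊎ (b < a × (a ≤ x ⊎ x ≤ b))

module IncreasingPolygon {k : ℕ} (f : Fin (3 + k) → ℕ)
  (f-increasing : ∀ i j → toℕ i < toℕ j → f i < f j) where

  f-<-at : ∀ {i j a b} → toℕ i ≡ a → toℕ j ≡ b → a < b → f i < f j
  f-<-at {i} {j} refl refl = f-increasing i j

  f-≤ : ∀ {i j} → toℕ i ≤ toℕ j → f i ≤ f j
  f-≤ {i} {j} i≤j with m≤n⇒m<n∨m≡n i≤j
  ... | inj₁ i<j = <⇒≤ (f-increasing i j i<j)
  ... | inj₂ i≡j rewrite toℕ-injective {i = i} {j = j} i≡j = ≤-refl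

  f-≤-at : ∀ {i j a b} → toℕ i ≡ a → toℕ j ≡ b → a ≤ b → f i ≤ f j
  f-≤-at refl refl = f-≤

  prv≤ : ∀ {j p} → toℕ j ≡ suc p → f (prv j) ≤ f j
  prv≤ {j} {p} j≡ = f-≤-at (toℕ-prv-suc j p j≡) j≡ (n≤1+n p)

  Arc ExitArc : Fin (3 + k) → ℕ → Set
  Arc j = InArc (f (nxt j)) (f j)
  ExitArc j = InArc (f (prv (prv j))) (f (prv j))

  arc-below : ∀ {j x} → toℕ j < 2 + k → x ≤ f j → Arc j x
  arc-below {j} j<last x≤ = inj₂ (f-<-at refl (toℕ-nxt j j<last) ≤-refl , inj₂ x≤)

  arc-above : ∀ {j x} → toℕ j < 2 + k → f (nxt j) ≤ x → Arc j x
  arc-above {j} j<last ≤x = inj₂ (f-<-at refl (toℕ-nxt j j<last) ≤-refl , inj₁ ≤x)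

  arc-above-at : ∀ {j i t b x} → toℕ j ≡ t → t < 2 + k → toℕ i ≡ b → suc t ≤ b → f i ≤ x
               → Arc j x
  arc-above-at {j} refl j<last i≡ j<i fi≤x =
    arc-above j<last (≤-trans (f-≤-at (toℕ-nxt j j<last) i≡ j<i) fi≤x)

  arc-last : ∀ {j x} → toℕ j ≡ 2 + k → f Fin.zero ≤ x → x ≤ f j → Arc j x
  arc-last {j} {x} j≡last ≤x x≤ = inj₁ (≤-trans first≤x x≤ , first≤x , x≤)
    where
    first≤x : f (nxt j) ≤ x
    first≤x = ≤-trans (f-≤-at (toℕ-nxt-last j j≡last) refl z≤n) ≤x

  vertex∈arc : ∀ j t → Arc j (f t)
  vertex∈arc j t with toℕ t ≤? toℕ j | last-or-before j
  ... | yes t≤j | inj₁ j≡last  = arc-last j≡last (f-≤ z≤n) (f-≤ t≤j)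
  ... | yes t≤j | inj₂ j<last  = arc-below j<last (f-≤ t≤j)
  ... | no t≰j  | _            =
    arc-above j<last (f-≤-at (toℕ-nxt j j<last) refl (≰⇒> t≰j))
    where
    j<last : toℕ j < 2 + k
    j<last = <-≤-trans (≰⇒> t≰j) (toℕ≤pred[n] t)

  exitArc⊆arc : ∀ j {x} → ExitArc j x → Arc j x
  exitArc⊆arc j {x} = by-position (toℕ j) refl
    where
    -- The exit arc [q_{j-2}, q_{j-1}] wraps around exactly when j = 1.
    by-position : ∀ t → toℕ j ≡ t → ExitArc j x → Arc j x
    by-position zero j≡ (inj₁ (_ , a≤x , _)) =
      arc-above-at j≡ z<s (toℕ-prv²-zero j j≡) (s≤s z≤n) a≤x
    by-position zero j≡ (inj₂ (b<a , _)) =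
      contradiction b<a (<-asym (f-<-at (toℕ-prv²-zero j j≡) (toℕ-prv-zero j j≡) (n<1+n _)))
    by-position (suc zero) j≡ (inj₁ (a≤b , _)) =
      contradiction a≤b (<⇒≱ (f-<-at (toℕ-prv-suc j 0 j≡) (toℕ-prv²-one j j≡) z<s))
    by-position (suc zero) j≡ (inj₂ (_ , inj₁ a≤x)) =
      arc-above-at j≡ (s≤s z<s) (toℕ-prv²-one j j≡) (s≤s (s≤s z≤n)) a≤x
    by-position (suc zero) j≡ (inj₂ (_ , inj₂ x≤b)) =
      arc-below (subst (_< 2 + k) (sym j≡) (s≤s z<s)) (≤-trans x≤b (prv≤ j≡))
    by-position (suc (suc p)) j≡ (inj₁ (_ , a≤x , x≤b)) with last-or-before j
    ... | inj₁ j≡last = arc-last j≡last (≤-trans (f-≤ z≤n) a≤x) (≤-trans x≤b (prv≤ j≡))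
    ... | inj₂ j<last = arc-below j<last (≤-trans x≤b (prv≤ j≡))
    by-position (suc (suc p)) j≡ (inj₂ (b<a , _)) =
      contradiction b<a (<-asym (f-<-at (toℕ-prv²-suc² j p j≡) (toℕ-prv-suc j (suc p) j≡) (n<1+n _)))

  vertex∉exitArc : ∀ j → ¬ ExitArc j (f j)
  vertex∉exitArc j = by-position (toℕ j) refl
    where
    by-position : ∀ t → toℕ j ≡ t → ¬ ExitArc j (f j)
    by-position zero j≡ (inj₁ (_ , a≤j , _)) =
      <⇒≱ (f-<-at j≡ (toℕ-prv²-zero j j≡) z<s) a≤j
    by-position zero j≡ (inj₂ (b<a , _)) =
      <-asym (f-<-at (toℕ-prv²-zero j j≡) (toℕ-prv-zero j j≡) (n<1+n _)) b<a
    by-position (suc zero) j≡ (inj₁ (a≤b , _)) =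
      <⇒≱ (f-<-at (toℕ-prv-suc j 0 j≡) (toℕ-prv²-one j j≡) z<s) a≤b
    by-position (suc zero) j≡ (inj₂ (_ , inj₁ a≤j)) =
      <⇒≱ (f-<-at j≡ (toℕ-prv²-one j j≡) (s≤s z<s)) a≤j
    by-position (suc zero) j≡ (inj₂ (_ , inj₂ j≤b)) =
      <⇒≱ (f-<-at (toℕ-prv-suc j 0 j≡) j≡ z<s) j≤b
    by-position (suc (suc p)) j≡ (inj₁ (_ , _ , j≤b)) =
      <⇒≱ (f-<-at (toℕ-prv-suc j (suc p) j≡) j≡ (n<1+n _)) j≤b
    by-position (suc (suc p)) j≡ (inj₂ (b<a , _)) =
      <-asym (f-<-at (toℕ-prv²-suc² j p j≡) (toℕ-prv-suc j (suc p) j≡) (n<1+n _)) b<a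

Arc : {n : ℕ} → Segment n → ℕ → Set
Arc s = InArc (toℕ (inTo s)) (toℕ (inFrom s))

ExitArc : {n : ℕ} → Segment n → ℕ → Set
ExitArc s = InArc (toℕ (outFrom s)) (toℕ (outTo s))

module _ {n : ℕ} {T : Tiling n} where

  private
    module Tile (s : Segment n) (tile-s : IsTile T (tile s)) =
      IncreasingPolygon (λ i → toℕ (v s i)) (IsTile.increasing tile-s)

  exitArc⊆arc : ∀ s → IsTile T (tile s) → ∀ {x} → ExitArc s x → Arc s x
  exitArc⊆arc s tile-s = Tile.exitArc⊆arc s tile-s (idx s)

  entry∉exitArc : ∀ s → IsTile T (tile s) → ¬ ExitArc s (toℕ (inFrom s))
  entry∉exitArc s tile-s = Tile.vertex∉exitArc s tile-s (idx s)

  entry∈arc-of-same-tile : ∀ s s' → tile s ≡ tile s' → IsTile T (tile s')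
                         → Arc s' (toℕ (inFrom s))
  entry∈arc-of-same-tile (seg _ _ j) s'@(seg _ _ j') refl tile-s' = Tile.vertex∈arc s' tile-s' j' j

  arc⊆exitArc-of-continued : ∀ s s' → Continues T s s' → ∀ {x} → Arc s' x → ExitArc s x
  arc⊆exitArc-of-continued _ _ (_ , in≡out , to≡from) {x} =
    subst₂ (λ a b → InArc a b x) (cong toℕ to≡from) (cong toℕ in≡out)

module _ {n : ℕ} {T : Tiling n} {m : ℕ} {s : Fin (suc m) → Segment n}
  (strand : IsStrand T m s) where

  open IsStrand strand

  arc⊆exitArc-of-earlier : ∀ j i → toℕ i < toℕ j → ∀ {x} → Arc (s j) x → ExitArc (s i) x
  arc⊆exitArc-of-earlier = <-weakInduction NestedBelow (λ _ ()) step
    where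
    NestedBelow : Fin (suc m) → Set
    NestedBelow j = ∀ i → toℕ i < toℕ j → ∀ {x} → Arc (s j) x → ExitArc (s i) x
    step : ∀ j → NestedBelow (inject₁ j) → NestedBelow (Fin.suc j)
    step j ih i i<1+j h
      with i Fin.≟ inject₁ j
         | arc⊆exitArc-of-continued {T = T} (s (inject₁ j)) (s (Fin.suc j)) (linked j) h
    ... | yes refl | exit = exit
    ... | no i≢j   | exit =
      ih i (Finₚ.≤∧≢⇒< i≤j i≢j) (exitArc⊆arc (s (inject₁ j)) (segTiles (inject₁ j)) exit)
      where
      i≤j : toℕ i ≤ toℕ (inject₁ j)
      i≤j = subst (toℕ i ≤_) (sym (toℕ-inject₁ j)) (s≤s⁻¹ i<1+j)

  earlier-tile≢later-tile : ∀ i j → toℕ i < toℕ j → ¬ (tile (s i) ≡ tile (s j))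
  earlier-tile≢later-tile i j i<j same =
    entry∉exitArc (s i) (segTiles i)
      (arc⊆exitArc-of-earlier j i i<j (entry∈arc-of-same-tile (s i) (s j) same (segTiles j)))

mainTheorem6 : (n : ℕ) → 3 ≤ n → (T : Tiling n) → (m : ℕ)
    → (s : Fin (suc m) → Segment n) → IsStrand T m s
    → (i j : Fin (suc m)) → ¬ (i ≡ j) → ¬ (tile (s i) ≡ tile (s j))
mainTheorem6 _ _ _ _ _ strand i j i≢j with <-cmp (toℕ i) (toℕ j)
... | tri< i<j _ _ = earlier-tile≢later-tile strand i j i<j
... | tri≈ _ i≡j _ = contradiction (toℕ-injective i≡j) i≢j
... | tri> _ _ j<i = earlier-tile≢later-tile strand j i j<i ∘ sym
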